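{- For every positive integer $d$, $\mathsf{s}_4(\mathbb{Z}_2^d) = \beta_4(d) + 3 = N(d,5) + 4$.
   Context: $\mathsf{s}_{4}(\mathbb{Z}_2^d)$ denotes the smallest integer $s$ such that every sequence (repetitions allowed) of length $s$ of elements of $\mathbb{Z}_2^d$ has a subsequence of length $4$ whose elements sum to $0$. $\beta_4(d)$ denotes the largest size of a set $A \subseteq \mathbb{Z}_2^d$ (of distinct elements) with no $4$-element subset summing to $0$. A linear binary code of length $n$ is a subspace $C \subseteq \mathbb{F}_2^n$; its redundancy is $n - \dim C$ and its distance is the minimum Hamming weight of a nonzero word (the zero code has distance $\infty$). $N(r,\delta)$ denotes the largest $n$ such that there is a linear binary code of length $n$, redundancy $r$ and distance at least $\delta$. -}

module Defs where

open import Data.Bool using (Bool; true; false; _xor_)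
open import Data.Nat using (ℕ; zero; suc; _+_; _∸_; _≤_; _<_)
open import Data.Fin using (Fin)
open import Data.Vec using (Vec; []; _∷_; zipWith; replicate; foldr; count)
open import Data.Product using (Σ; ∃; _×_; _,_)
open import Relation.Binary.PropositionalEquality using (_≡_)
open import Relation.Nullary using (¬_)
open import Data.Bool.Properties using (T?)
open import Function.Definitions using (Injective)

V : ℕ → Set
V d = Vec Bool d

_⊕_ : ∀ {d} → V d → V d → V d
_⊕_ = zipWith _xor_

0V : ∀ {d} → V d
0V = replicate _ false

HasZeroSum4 : ∀ {d s} → (Fin s → V d) → Set
HasZeroSum4 {d} {s} f =
  Σ (Fin s) λ i → Σ (Fin s) λ j → Σ (Fin s) λ k → Σ (Fin s) λ l →
    (Data.Fin._<_ i j × Data.Fin._<_ j k × Data.Fin._<_ k l) ×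
    ((f i ⊕ f j) ⊕ (f k ⊕ f l)) ≡ 0V

S4Property : ℕ → ℕ → Set
S4Property d s = (f : Fin s → V d) → HasZeroSum4 f

IsS4 : ℕ → ℕ → Set
IsS4 d s = S4Property d s × (∀ t → S4Property d t → s ≤ t)

-- a set of m distinct elements of Z_2^d (an injective enumeration)
-- with no 4-element subset summing to 0
Beta4Set : ℕ → ℕ → Set
Beta4Set d m = Σ (Fin m → V d) λ f → Injective _≡_ _≡_ f × ¬ HasZeroSum4 f

IsBeta4 : ℕ → ℕ → Set
IsBeta4 d b = Beta4Set d b × (∀ m → Beta4Set d m → m ≤ b)

lincomb : ∀ {n k} → Vec Bool k → Vec (V n) k → V n
lincomb [] [] = 0V
lincomb (c ∷ cs) (g ∷ gs) = (if′ c g) ⊕ lincomb cs gs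
  where
  if′ : Bool → V _ → V _
  if′ true v = v
  if′ false _ = 0V

weight : ∀ {n} → V n → ℕ
weight = count T?

-- A linear binary code of length n, redundancy r (so dimension n ∸ r, r ≤ n)
-- and distance at least δ, given by a basis g (linearly independent family
-- of n ∸ r vectors of F_2^n spanning C); every nonzero codeword is
-- lincomb c g with c ≠ 0, so the distance condition reads as below.
-- (The zero code, n ∸ r = 0, has distance ∞ and satisfies it vacuously.)
CodeExists : ℕ → ℕ → ℕ → Set
CodeExists n r δ =
  r ≤ n × Σ (Vec (V n) (n ∸ r)) λ g →
    (∀ c → lincomb c g ≡ 0V → c ≡ 0V) ×
    (∀ c → ¬ (c ≡ 0V) → δ ≤ weight (lincomb c g))

IsN : ℕ → ℕ → ℕ → Set
IsN r δ n = CodeExists n r δ × (∀ m → CodeExists m r δ → m ≤ n)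

module Submission where

-- β = β₄(d) exists because "there are m distinct elements with no zero-sum
-- 4-subset" is decidable and fails for m > 2ᵈ; the singleton {0} shows β ≥ 1.
--
-- s₄ = β + 3.  In a zero-sum-free sequence of length β + 3 every subsequence
-- longer than β repeats an element, so deleting repeated entries twice yields
-- three repetitions x = x', y = y', z = z'; two of them with disjoint positions
-- give the zero sum x + x + y + y.  Conversely a maximal zero-sum-free set with
-- its first element repeated twice more is a zero-sum-free sequence of length
-- β + 2.
--
-- N(d,5) = β - 1.  Translate a maximal zero-sum-free set to {0, h₁, …, hₙ}; by
-- maximality the hⱼ span ℤ₂ᵈ, the kernel of x ↦ Σ xⱼhⱼ has a basis of n - d
-- vectors, and a nonzero kernel vector of weight ≤ 4 would give a zero sum of
-- at most four set elements.  Conversely, a parity-check map φ of a code with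
-- distance ≥ 5 yields the zero-sum-free set {0, φe₁, …, φeₙ}.

open import Defs
open import Data.Nat using (ℕ; _+_; _≤_)
open import Data.Product using (Σ; _×_)
open import Relation.Binary.PropositionalEquality using (_≡_)

open import Data.Bool using (Bool; true; false; _xor_; _∧_)
open import Data.Bool.Properties
  using (xor-assoc; xor-comm; xor-identityˡ; xor-identityʳ; xor-same; ∧-identityʳ; ∧-zeroʳ; ¬-not)
  renaming (_≟_ to _≟B_)
open import Data.Nat using (zero; suc; _∸_; _<_; _^_; z≤n; s≤s; s≤s⁻¹)
open import Data.Nat.Properties as ℕP using (+-identityʳ; +-suc; +-comm; n≮n)
open import Data.Fin as F using (Fin; zero; suc; punchIn)
open import Data.Fin.Properties as FP using (any?; all?; punchIn-injective; punchInᵢ≢i; <⇒≢)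
open import Data.Vec using (Vec; []; _∷_; lookup; tabulate; head; tail; map; insertAt; removeAt)
open import Data.Vec.Properties
  using (lookup-zipWith; lookup-replicate; lookup-map; lookup∘tabulate; ≡-dec; removeAt-insertAt; insertAt-removeAt)
open import Data.Vec.Relation.Binary.Pointwise.Inductive
  using (Pointwise-≡⇒≡; zipWith-assoc; zipWith-comm; zipWith-identityˡ; zipWith-identityʳ)
open import Data.Vec.Functional using () renaming (_∷_ to _◂_)
open import Data.List as L using (List; []; _∷_; length)
open import Data.List.Properties using (length-map)
open import Data.Product using (_,_; proj₁; proj₂)
open import Data.Sum using (_⊎_; inj₁; inj₂)
open import Data.Empty using (⊥; ⊥-elim)
open import Data.Unit using (⊤; tt)
open import Function using (_∘_)
open import Function.Definitions using (Injective)
open import Relation.Nullary using (¬_; Dec; yes; no)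
open import Relation.Nullary.Decidable using (_×-dec_; _→-dec_; ¬?)
open import Relation.Binary.PropositionalEquality
  using (refl; sym; trans; cong; cong₂; subst; _≢_; module ≡-Reasoning)
open ≡-Reasoning

⊕-assoc : ∀ {n} (x y z : V n) → (x ⊕ y) ⊕ z ≡ x ⊕ (y ⊕ z)
⊕-assoc x y z = Pointwise-≡⇒≡ (zipWith-assoc xor-assoc x y z)

⊕-comm : ∀ {n} (x y : V n) → x ⊕ y ≡ y ⊕ x
⊕-comm x y = Pointwise-≡⇒≡ (zipWith-comm xor-comm x y)

⊕-identityˡ : ∀ {n} (x : V n) → 0V ⊕ x ≡ x
⊕-identityˡ x = Pointwise-≡⇒≡ (zipWith-identityˡ xor-identityˡ x)

⊕-identityʳ : ∀ {n} (x : V n) → x ⊕ 0V ≡ x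
⊕-identityʳ x = Pointwise-≡⇒≡ (zipWith-identityʳ xor-identityʳ x)

⊕-self : ∀ {n} (x : V n) → x ⊕ x ≡ 0V
⊕-self [] = refl
⊕-self (a ∷ x) = cong₂ _∷_ (xor-same a) (⊕-self x)

⊕-interchange : ∀ {n} (a b c d : V n) → (a ⊕ b) ⊕ (c ⊕ d) ≡ (a ⊕ c) ⊕ (b ⊕ d)
⊕-interchange a b c d = begin
  (a ⊕ b) ⊕ (c ⊕ d) ≡⟨ ⊕-assoc a b (c ⊕ d) ⟩
  a ⊕ (b ⊕ (c ⊕ d)) ≡⟨ cong (a ⊕_) (sym (⊕-assoc b c d)) ⟩
  a ⊕ ((b ⊕ c) ⊕ d) ≡⟨ cong (λ t → a ⊕ (t ⊕ d)) (⊕-comm b c) ⟩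
  a ⊕ ((c ⊕ b) ⊕ d) ≡⟨ cong (a ⊕_) (⊕-assoc c b d) ⟩
  a ⊕ (c ⊕ (b ⊕ d)) ≡⟨ sym (⊕-assoc a c (b ⊕ d)) ⟩
  (a ⊕ c) ⊕ (b ⊕ d) ∎

⊕-absorbˡ : ∀ {n} (a b : V n) → a ⊕ (a ⊕ b) ≡ b
⊕-absorbˡ a b = begin
  a ⊕ (a ⊕ b) ≡⟨ sym (⊕-assoc a a b) ⟩
  (a ⊕ a) ⊕ b ≡⟨ cong (_⊕ b) (⊕-self a) ⟩
  0V ⊕ b      ≡⟨ ⊕-identityˡ b ⟩
  b           ∎

⊕-absorbʳ : ∀ {n} (a c : V n) → (a ⊕ c) ⊕ c ≡ a
⊕-absorbʳ a c = begin
  (a ⊕ c) ⊕ c ≡⟨ ⊕-assoc a c c ⟩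
  a ⊕ (c ⊕ c) ≡⟨ cong (a ⊕_) (⊕-self c) ⟩
  a ⊕ 0V      ≡⟨ ⊕-identityʳ a ⟩
  a           ∎

⊕-injectiveʳ : ∀ {n} {a b c : V n} → a ⊕ c ≡ b ⊕ c → a ≡ b
⊕-injectiveʳ {a = a} {b} {c} q = begin
  a           ≡⟨ sym (⊕-absorbʳ a c) ⟩
  (a ⊕ c) ⊕ c ≡⟨ cong (_⊕ c) q ⟩
  (b ⊕ c) ⊕ c ≡⟨ ⊕-absorbʳ b c ⟩
  b           ∎

⊕≡0⇒≡ : ∀ {n} {x y : V n} → x ⊕ y ≡ 0V → x ≡ y
⊕≡0⇒≡ {y = y} q = ⊕-injectiveʳ (trans q (sym (⊕-self y)))

≡⇒⊕≡0 : ∀ {n} {x y : V n} → x ≡ y → x ⊕ y ≡ 0V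
≡⇒⊕≡0 {x = x} refl = ⊕-self x

⊕-translate : ∀ {n} (a b z : V n) → (a ⊕ z) ⊕ (b ⊕ z) ≡ a ⊕ b
⊕-translate a b z = begin
  (a ⊕ z) ⊕ (b ⊕ z) ≡⟨ ⊕-interchange a z b z ⟩
  (a ⊕ b) ⊕ (z ⊕ z) ≡⟨ cong ((a ⊕ b) ⊕_) (⊕-self z) ⟩
  (a ⊕ b) ⊕ 0V      ≡⟨ ⊕-identityʳ _ ⟩
  a ⊕ b             ∎

lookup-⊕ : ∀ {n} (x y : V n) (a : Fin n) → lookup (x ⊕ y) a ≡ lookup x a xor lookup y a
lookup-⊕ x y a = lookup-zipWith _xor_ a x y

lookup-0V : ∀ {n} (a : Fin n) → lookup (0V {n}) a ≡ false
lookup-0V a = lookup-replicate a false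

allFalse⇒0V : ∀ {n} (w : V n) → (∀ p → lookup w p ≡ false) → w ≡ 0V
allFalse⇒0V [] _ = refl
allFalse⇒0V (b ∷ w) h = cong₂ _∷_ (h zero) (allFalse⇒0V w (h ∘ suc))

V0-trivial : (v : V 0) → v ≡ 0V
V0-trivial [] = refl

xor≡false⇒≡ : ∀ {a b} → a xor b ≡ false → a ≡ b
xor≡false⇒≡ {true} {true} _ = refl
xor≡false⇒≡ {false} {false} _ = refl

scale : ∀ {n} → Bool → V n → V n
scale true v = v
scale false _ = 0V

scale-xor : ∀ {n} a b (v : V n) → scale (a xor b) v ≡ scale a v ⊕ scale b v
scale-xor true true v = sym (⊕-self v)
scale-xor true false v = sym (⊕-identityʳ v)
scale-xor false b v = sym (⊕-identityˡ (scale b v))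

lookup-scale : ∀ {n} b (v : V n) a → lookup (scale b v) a ≡ b ∧ lookup v a
lookup-scale true v a = refl
lookup-scale false v a = lookup-0V a

unit : ∀ {n} → Fin n → V n
unit zero = true ∷ 0V
unit (suc i) = false ∷ unit i

combo : ∀ {s d} → V s → (Fin s → V d) → V d
combo [] g = 0V
combo (b ∷ x) g = scale b (g zero) ⊕ combo x (g ∘ suc)

combo-⊕ : ∀ {s d} (x y : V s) (g : Fin s → V d) → combo (x ⊕ y) g ≡ combo x g ⊕ combo y g
combo-⊕ [] [] g = sym (⊕-self 0V)
combo-⊕ (a ∷ x) (b ∷ y) g = begin
  scale (a xor b) (g zero) ⊕ combo (x ⊕ y) (g ∘ suc)
    ≡⟨ cong₂ _⊕_ (scale-xor a b (g zero)) (combo-⊕ x y (g ∘ suc)) ⟩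
  (scale a (g zero) ⊕ scale b (g zero)) ⊕ (combo x (g ∘ suc) ⊕ combo y (g ∘ suc))
    ≡⟨ ⊕-interchange _ _ _ _ ⟩
  (scale a (g zero) ⊕ combo x (g ∘ suc)) ⊕ (scale b (g zero) ⊕ combo y (g ∘ suc)) ∎

combo-0V : ∀ {s d} (g : Fin s → V d) → combo (0V {s}) g ≡ 0V
combo-0V {zero} g = refl
combo-0V {suc s} g = trans (⊕-identityˡ _) (combo-0V {s} (g ∘ suc))

combo-unit : ∀ {s d} (a : Fin s) (g : Fin s → V d) → combo (unit a) g ≡ g a
combo-unit {suc s} zero g = trans (cong (g zero ⊕_) (combo-0V {s} (g ∘ suc))) (⊕-identityʳ _)
combo-unit (suc a) g = trans (⊕-identityˡ _) (combo-unit a (g ∘ suc))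

combo-unit⊕ : ∀ {s d} (a : Fin s) (x : V s) (g : Fin s → V d) → combo (unit a ⊕ x) g ≡ g a ⊕ combo x g
combo-unit⊕ a x g = trans (combo-⊕ (unit a) x g) (cong (_⊕ combo x g) (combo-unit a g))

combo-cong : ∀ {s d} (x : V s) {g g' : Fin s → V d} → (∀ i → g i ≡ g' i) → combo x g ≡ combo x g'
combo-cong [] h = refl
combo-cong (b ∷ x) h = cong₂ _⊕_ (cong (scale b) (h zero)) (combo-cong x (h ∘ suc))

combo-prepend-false : ∀ {s d} (x : V s) (h : Fin s → V d) → combo x (λ i → false ∷ h i) ≡ false ∷ combo x h
combo-prepend-false [] h = refl
combo-prepend-false (b ∷ x) h = cong₂ _⊕_ (scale-false b) (combo-prepend-false x (h ∘ suc))
  where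
  scale-false : ∀ b → scale b (false ∷ h zero) ≡ false ∷ scale b (h zero)
  scale-false true = refl
  scale-false false = refl

combo-units : ∀ {s} (x : V s) → combo x unit ≡ x
combo-units [] = refl
combo-units (b ∷ x) = begin
  scale b (true ∷ 0V) ⊕ combo x (unit ∘ suc) ≡⟨ cong (scale b (true ∷ 0V) ⊕_) (combo-prepend-false x unit) ⟩
  scale b (true ∷ 0V) ⊕ (false ∷ combo x unit) ≡⟨ cong (λ t → scale b (true ∷ 0V) ⊕ (false ∷ t)) (combo-units x) ⟩
  scale b (true ∷ 0V) ⊕ (false ∷ x) ≡⟨ leading b ⟩
  b ∷ x ∎
  where
  leading : ∀ b → scale b (true ∷ 0V) ⊕ (false ∷ x) ≡ b ∷ x
  leading true = cong (true ∷_) (⊕-identityˡ x)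
  leading false = cong (false ∷_) (⊕-identityˡ x)

lincomb≡combo : ∀ {n k} (c : Vec Bool k) (G : Vec (V n) k) → lincomb c G ≡ combo c (lookup G)
lincomb≡combo [] [] = refl
lincomb≡combo (true ∷ c) (g ∷ G) = cong (g ⊕_) (lincomb≡combo c G)
lincomb≡combo (false ∷ c) (g ∷ G) = cong (0V ⊕_) (lincomb≡combo c G)

IsLinear : ∀ {n m} → (V n → V m) → Set
IsLinear φ = ∀ x y → φ (x ⊕ y) ≡ φ x ⊕ φ y

∘-linear : ∀ {n m k} {ψ : V m → V k} {φ : V n → V m} → IsLinear ψ → IsLinear φ → IsLinear (ψ ∘ φ)
∘-linear {ψ = ψ} {φ} linψ linφ x y = trans (cong ψ (linφ x y)) (linψ (φ x) (φ y))

linear-0V : ∀ {n m} (φ : V n → V m) → IsLinear φ → φ 0V ≡ 0V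
linear-0V φ lin = begin
  φ 0V         ≡⟨ cong φ (sym (⊕-self 0V)) ⟩
  φ (0V ⊕ 0V)  ≡⟨ lin 0V 0V ⟩
  φ 0V ⊕ φ 0V  ≡⟨ ⊕-self _ ⟩
  0V           ∎

linear-scale : ∀ {n m} (φ : V n → V m) → IsLinear φ → ∀ b v → φ (scale b v) ≡ scale b (φ v)
linear-scale φ lin true v = refl
linear-scale φ lin false v = linear-0V φ lin

linear-combo : ∀ {s n m} (φ : V n → V m) → IsLinear φ → (x : V s) (g : Fin s → V n) →
  φ (combo x g) ≡ combo x (φ ∘ g)
linear-combo φ lin [] g = linear-0V φ lin
linear-combo φ lin (b ∷ x) g =
  trans (lin _ _) (cong₂ _⊕_ (linear-scale φ lin b (g zero)) (linear-combo φ lin x (g ∘ suc)))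

lincomb-map : ∀ {n m k} (φ : V n → V m) → IsLinear φ → (c : Vec Bool k) (g : Vec (V n) k) →
  lincomb c (map φ g) ≡ φ (lincomb c g)
lincomb-map φ lin c g = begin
  lincomb c (map φ g)          ≡⟨ lincomb≡combo c _ ⟩
  combo c (lookup (map φ g))   ≡⟨ combo-cong c (λ i → lookup-map i φ g) ⟩
  combo c (φ ∘ lookup g)       ≡⟨ sym (linear-combo φ lin c (lookup g)) ⟩
  φ (combo c (lookup g))       ≡⟨ cong φ (sym (lincomb≡combo c g)) ⟩
  φ (lincomb c g)              ∎

weight-0V : ∀ {n} → weight (0V {n}) ≡ 0
weight-0V {zero} = refl
weight-0V {suc n} = weight-0V {n}

weight≡0⇒0V : ∀ {n} (x : V n) → weight x ≡ 0 → x ≡ 0V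
weight≡0⇒0V [] _ = refl
weight≡0⇒0V (false ∷ x) h = cong (false ∷_) (weight≡0⇒0V x h)

weight≡suc⇒≢0V : ∀ {n k} (x : V n) → weight x ≡ suc k → x ≢ 0V
weight≡suc⇒≢0V {n} x h refl with trans (sym (weight-0V {n})) h
... | ()

weight-positive : ∀ {n} (x : V n) → x ≢ 0V → 1 ≤ weight x
weight-positive x x≢0 with weight x | weight≡0⇒0V x
... | zero | w≡0⇒x≡0 = ⊥-elim (x≢0 (w≡0⇒x≡0 refl))
... | suc _ | _ = s≤s z≤n

lookup-unit-≢ : ∀ {n} (a b : Fin n) → a ≢ b → lookup (unit b) a ≡ false
lookup-unit-≢ zero zero a≢b = ⊥-elim (a≢b refl)
lookup-unit-≢ zero (suc b) _ = refl
lookup-unit-≢ (suc a) zero _ = lookup-0V a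
lookup-unit-≢ (suc a) (suc b) a≢b = lookup-unit-≢ a b (a≢b ∘ cong suc)

weight-unit⊕ : ∀ {n} (a : Fin n) (y : V n) → lookup y a ≡ false → weight (unit a ⊕ y) ≡ suc (weight y)
weight-unit⊕ zero (false ∷ y) refl = cong suc (cong weight (⊕-identityˡ y))
weight-unit⊕ (suc a) (true ∷ y) h = cong suc (weight-unit⊕ a y h)
weight-unit⊕ (suc a) (false ∷ y) h = weight-unit⊕ a y h

weight-unit : ∀ {n} (a : Fin n) → weight (unit a) ≡ 1
weight-unit {n} a = begin
  weight (unit a)        ≡⟨ cong weight (sym (⊕-identityʳ (unit a))) ⟩
  weight (unit a ⊕ 0V)   ≡⟨ weight-unit⊕ a 0V (lookup-0V a) ⟩
  suc (weight (0V {n}))  ≡⟨ cong suc (weight-0V {n}) ⟩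
  1                      ∎

lookup-units₂ : ∀ {n} {u v w : Fin n} → u ≢ v → u ≢ w → lookup (unit v ⊕ unit w) u ≡ false
lookup-units₂ {u = u} {v} {w} u≢v u≢w =
  trans (lookup-⊕ (unit v) (unit w) u) (cong₂ _xor_ (lookup-unit-≢ u v u≢v) (lookup-unit-≢ u w u≢w))

weight-units₂ : ∀ {n} {a b : Fin n} → a ≢ b → weight (unit a ⊕ unit b) ≡ 2
weight-units₂ {a = a} {b} a≢b = trans (weight-unit⊕ a (unit b) (lookup-unit-≢ a b a≢b)) (cong suc (weight-unit b))

weight-units₃ : ∀ {n} {a b c : Fin n} → a ≢ b → a ≢ c → b ≢ c → weight (unit a ⊕ (unit b ⊕ unit c)) ≡ 3
weight-units₃ {a = a} a≢b a≢c b≢c = trans (weight-unit⊕ a _ (lookup-units₂ a≢b a≢c)) (cong suc (weight-units₂ b≢c))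

weight-units₄ : ∀ {n} {a b c k : Fin n} → a ≢ b → a ≢ c → a ≢ k → b ≢ c → b ≢ k → c ≢ k →
  weight (unit a ⊕ (unit b ⊕ (unit c ⊕ unit k))) ≡ 4
weight-units₄ {a = a} {b} a≢b a≢c a≢k b≢c b≢k c≢k =
  trans (weight-unit⊕ a _ a-free) (cong suc (weight-units₃ b≢c b≢k c≢k))
  where
  a-free : lookup (unit b ⊕ (unit _ ⊕ unit _)) a ≡ false
  a-free = trans (lookup-⊕ (unit b) _ a) (cong₂ _xor_ (lookup-unit-≢ a b a≢b) (lookup-units₂ a≢c a≢k))

Sorted : ∀ {s} → List (Fin s) → Set
Sorted [] = ⊤
Sorted (a ∷ []) = ⊤
Sorted (a ∷ b ∷ l) = a F.< b × Sorted (b ∷ l)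

sumOver : ∀ {s d} → (Fin s → V d) → List (Fin s) → V d
sumOver g [] = 0V
sumOver g (a ∷ l) = g a ⊕ sumOver g l

support : ∀ {s} → V s → List (Fin s)
support [] = []
support (true ∷ x) = zero ∷ L.map suc (support x)
support (false ∷ x) = L.map suc (support x)

sorted-map-suc : ∀ {s} (l : List (Fin s)) → Sorted l → Sorted (L.map suc l)
sorted-map-suc [] _ = tt
sorted-map-suc (a ∷ []) _ = tt
sorted-map-suc (a ∷ b ∷ l) (a<b , sorted) = s≤s a<b , sorted-map-suc (b ∷ l) sorted

sorted-support : ∀ {s} (x : V s) → Sorted (support x)
sorted-support [] = tt
sorted-support (true ∷ x) with support x | sorted-support x
... | [] | _ = tt
... | b ∷ l | sorted = s≤s z≤n , sorted-map-suc (b ∷ l) sorted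
sorted-support (false ∷ x) = sorted-map-suc (support x) (sorted-support x)

length-support : ∀ {s} (x : V s) → length (support x) ≡ weight x
length-support [] = refl
length-support (true ∷ x) = cong suc (trans (length-map suc (support x)) (length-support x))
length-support (false ∷ x) = trans (length-map suc (support x)) (length-support x)

sumOver-map-suc : ∀ {s d} (g : Fin (suc s) → V d) (l : List (Fin s)) →
  sumOver g (L.map suc l) ≡ sumOver (g ∘ suc) l
sumOver-map-suc g [] = refl
sumOver-map-suc g (a ∷ l) = cong (g (suc a) ⊕_) (sumOver-map-suc g l)

combo≡sumOver-support : ∀ {s d} (x : V s) (g : Fin s → V d) → combo x g ≡ sumOver g (support x)
combo≡sumOver-support [] g = refl
combo≡sumOver-support (true ∷ x) g =
  cong (g zero ⊕_) (trans (combo≡sumOver-support x _) (sym (sumOver-map-suc g (support x))))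
combo≡sumOver-support (false ∷ x) g =
  trans (⊕-identityˡ _) (trans (combo≡sumOver-support x _) (sym (sumOver-map-suc g (support x))))

-- Zero sums of four distinct entries.  HasZeroSum4 asks for increasing
-- positions; any four distinct positions can be sorted by passing through the
-- support of the sum of their unit vectors.

zeroSum4-sorted : ∀ {s d} (g : Fin s → V d) (l : List (Fin s)) →
  length l ≡ 4 → Sorted l → sumOver g l ≡ 0V → HasZeroSum4 g
zeroSum4-sorted g (p ∷ q ∷ r ∷ t ∷ []) refl (p<q , q<r , r<t , _) sum≡0 =
  p , q , r , t , (p<q , q<r , r<t) , (begin
    (g p ⊕ g q) ⊕ (g r ⊕ g t)        ≡⟨ ⊕-assoc (g p) (g q) _ ⟩
    g p ⊕ (g q ⊕ (g r ⊕ g t))        ≡⟨ cong (λ z → g p ⊕ (g q ⊕ (g r ⊕ z))) (sym (⊕-identityʳ (g t))) ⟩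
    sumOver g (p ∷ q ∷ r ∷ t ∷ [])   ≡⟨ sum≡0 ⟩
    0V                               ∎)

zeroSum4-distinct : ∀ {s d} (g : Fin s → V d) (a b c k : Fin s) →
  a ≢ b → a ≢ c → a ≢ k → b ≢ c → b ≢ k → c ≢ k →
  (g a ⊕ g b) ⊕ (g c ⊕ g k) ≡ 0V → HasZeroSum4 g
zeroSum4-distinct {s} g a b c k a≢b a≢c a≢k b≢c b≢k c≢k sum≡0 =
  zeroSum4-sorted g (support x) (trans (length-support x) (weight-units₄ a≢b a≢c a≢k b≢c b≢k c≢k))
    (sorted-support x) (trans (sym (combo≡sumOver-support x g)) combo≡0)
  where
  x : V s
  x = unit a ⊕ (unit b ⊕ (unit c ⊕ unit k))
  combo≡0 : combo x g ≡ 0V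
  combo≡0 = begin
    combo x g                    ≡⟨ combo-unit⊕ a _ g ⟩
    g a ⊕ combo (unit b ⊕ (unit c ⊕ unit k)) g ≡⟨ cong (g a ⊕_) (combo-unit⊕ b _ g) ⟩
    g a ⊕ (g b ⊕ combo (unit c ⊕ unit k) g) ≡⟨ cong (λ t → g a ⊕ (g b ⊕ t)) (combo-unit⊕ c _ g) ⟩
    g a ⊕ (g b ⊕ (g c ⊕ combo (unit k) g)) ≡⟨ cong (λ t → g a ⊕ (g b ⊕ (g c ⊕ t))) (combo-unit k g) ⟩
    g a ⊕ (g b ⊕ (g c ⊕ g k))    ≡⟨ sym (⊕-assoc (g a) (g b) _) ⟩
    (g a ⊕ g b) ⊕ (g c ⊕ g k)    ≡⟨ sum≡0 ⟩
    0V                           ∎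

zeroSum4-reindex : ∀ {s t d} (g : Fin s → V d) (ι : Fin t → Fin s) → Injective _≡_ _≡_ ι →
  HasZeroSum4 (g ∘ ι) → HasZeroSum4 g
zeroSum4-reindex g ι ι-inj (i , j , k , l , (i<j , j<k , k<l) , sum≡0) =
  zeroSum4-distinct g (ι i) (ι j) (ι k) (ι l) (apart i<j) (apart (FP.<-trans i<j j<k))
    (apart (FP.<-trans i<j (FP.<-trans j<k k<l))) (apart j<k) (apart (FP.<-trans j<k k<l)) (apart k<l) sum≡0
  where
  apart : ∀ {a b} → a F.< b → ι a ≢ ι b
  apart a<b = <⇒≢ a<b ∘ ι-inj

zeroSum4-cong : ∀ {s d} {g g' : Fin s → V d} → (∀ i → g i ≡ g' i) → HasZeroSum4 g → HasZeroSum4 g'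
zeroSum4-cong g≗g' (i , j , k , l , ordered , sum≡0) = i , j , k , l , ordered ,
  trans (sym (cong₂ _⊕_ (cong₂ _⊕_ (g≗g' i) (g≗g' j)) (cong₂ _⊕_ (g≗g' k) (g≗g' l)))) sum≡0

zeroSum4-twoPairs : ∀ {s d} (g : Fin s → V d) (a b c k : Fin s) →
  a ≢ b → a ≢ c → a ≢ k → b ≢ c → b ≢ k → c ≢ k → g a ≡ g b → g c ≡ g k → HasZeroSum4 g
zeroSum4-twoPairs g a b c k a≢b a≢c a≢k b≢c b≢k c≢k ga≡gb gc≡gk = zeroSum4-distinct g a b c k
  a≢b a≢c a≢k b≢c b≢k c≢k (trans (cong₂ _⊕_ (≡⇒⊕≡0 ga≡gb) (≡⇒⊕≡0 gc≡gk)) (⊕-identityˡ 0V))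

ZeroSumWith : ∀ {s d} → (Fin s → V d) → V d → Set
ZeroSumWith {s} g x = Σ (Fin s) λ j → Σ (Fin s) λ k → Σ (Fin s) λ l →
  (j F.< k × k F.< l) × ((x ⊕ g j) ⊕ (g k ⊕ g l)) ≡ 0V

zeroSum4-prepend : ∀ {s d} (x : V d) (g : Fin s → V d) → HasZeroSum4 (x ◂ g) → HasZeroSum4 g ⊎ ZeroSumWith g x
zeroSum4-prepend x g (zero , suc j , suc k , suc l , (_ , s≤s j<k , s≤s k<l) , sum≡0) =
  inj₂ (j , k , l , (j<k , k<l) , sum≡0)
zeroSum4-prepend x g (suc i , suc j , suc k , suc l , (s≤s i<j , s≤s j<k , s≤s k<l) , sum≡0) =
  inj₁ (i , j , k , l , (i<j , j<k , k<l) , sum≡0)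
zeroSum4-prepend x g (zero , zero , _ , _ , (() , _) , _)
zeroSum4-prepend x g (_ , suc j , zero , _ , (_ , () , _) , _)
zeroSum4-prepend x g (_ , _ , suc k , zero , (_ , _ , ()) , _)
zeroSum4-prepend x g (suc i , zero , _ , _ , (() , _) , _)

insertAt-⊕ : ∀ {n} (x y : V n) p a b → insertAt (x ⊕ y) p (a xor b) ≡ insertAt x p a ⊕ insertAt y p b
insertAt-⊕ x y zero a b = refl
insertAt-⊕ (u ∷ x) (v ∷ y) (suc p) a b = cong ((u xor v) ∷_) (insertAt-⊕ x y p a b)

insertAt-0V : ∀ {n} (p : Fin (suc n)) → insertAt (0V {n}) p false ≡ 0V
insertAt-0V zero = refl
insertAt-0V {suc n} (suc p) = cong (false ∷_) (insertAt-0V p)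

unit≡insertAt : ∀ {n} (p : Fin (suc n)) → unit p ≡ insertAt 0V p true
unit≡insertAt zero = refl
unit≡insertAt {suc n} (suc p) = cong (false ∷_) (unit≡insertAt p)

removeAt-⊕ : ∀ {n} (u v : V (suc n)) p → removeAt (u ⊕ v) p ≡ removeAt u p ⊕ removeAt v p
removeAt-⊕ (a ∷ u) (b ∷ v) zero = refl
removeAt-⊕ (a ∷ a' ∷ u) (b ∷ b' ∷ v) (suc p) = cong ((a xor b) ∷_) (removeAt-⊕ (a' ∷ u) (b' ∷ v) p)

removeAt-0V : ∀ {n} (p : Fin (suc n)) → removeAt (0V {suc n}) p ≡ 0V
removeAt-0V p = trans (cong (λ t → removeAt t p) (sym (insertAt-0V p))) (removeAt-insertAt 0V p false)

removeAt-scale-unit : ∀ {n} b (p : Fin (suc n)) → removeAt (scale b (unit p)) p ≡ 0V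
removeAt-scale-unit true p = trans (cong (λ t → removeAt t p) (unit≡insertAt p)) (removeAt-insertAt 0V p true)
removeAt-scale-unit false p = removeAt-0V p

insertAt-split : ∀ {n} (w : V n) p b → insertAt w p b ≡ insertAt w p false ⊕ scale b (unit p)
insertAt-split w p false = sym (⊕-identityʳ _)
insertAt-split w p true = begin
  insertAt w p true                         ≡⟨ cong (λ t → insertAt t p true) (sym (⊕-identityʳ w)) ⟩
  insertAt (w ⊕ 0V) p (false xor true)      ≡⟨ insertAt-⊕ w 0V p false true ⟩
  insertAt w p false ⊕ insertAt 0V p true   ≡⟨ cong (insertAt w p false ⊕_) (sym (unit≡insertAt p)) ⟩
  insertAt w p false ⊕ unit p               ∎

decompose : ∀ {n} (u : V (suc n)) p → u ≡ insertAt (removeAt u p) p false ⊕ scale (lookup u p) (unit p)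
decompose u p = trans (sym (insertAt-removeAt u p)) (insertAt-split (removeAt u p) p (lookup u p))

removeAt≡0⇒0V : ∀ {n} (t : V (suc n)) p → lookup t p ≡ false → removeAt t p ≡ 0V → t ≡ 0V
removeAt≡0⇒0V t p tₚ≡0 rest≡0 = begin
  t                                                    ≡⟨ decompose t p ⟩
  insertAt (removeAt t p) p false ⊕ scale (lookup t p) (unit p) ≡⟨ cong₂ (λ r b → insertAt r p false ⊕ scale b (unit p)) rest≡0 tₚ≡0 ⟩
  insertAt 0V p false ⊕ 0V                             ≡⟨ ⊕-identityʳ _ ⟩
  insertAt 0V p false                                  ≡⟨ insertAt-0V p ⟩
  0V                                                   ∎

InSpan : ∀ {n k} → Vec (V n) k → V n → Set
InSpan {k = k} g x = Σ (Vec Bool k) λ c → lincomb c g ≡ x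

Independent : ∀ {n k} → Vec (V n) k → Set
Independent g = ∀ c → lincomb c g ≡ 0V → c ≡ 0V

KernelInSpan : ∀ {n m k} → (V n → V m) → Vec (V n) k → Set
KernelInSpan φ g = ∀ x → φ x ≡ 0V → InSpan g x

SpanInKernel : ∀ {n m k} → (V n → V m) → Vec (V n) k → Set
SpanInKernel φ g = ∀ c → φ (lincomb c g) ≡ 0V

IsSurjective : ∀ {n m} → (V n → V m) → Set
IsSurjective {n} φ = ∀ y → Σ (V n) λ x → φ x ≡ y

independent-tail : ∀ {n k} {h : V n} {gs : Vec (V n) k} → Independent (h ∷ gs) → Independent gs
independent-tail ind c q = cong tail (ind (false ∷ c) (trans (⊕-identityˡ _) q))

units-independent : ∀ {n} → Independent (tabulate (unit {n}))
units-independent c q = begin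
  c                                ≡⟨ sym (combo-units c) ⟩
  combo c unit                     ≡⟨ combo-cong c (λ i → sym (lookup∘tabulate unit i)) ⟩
  combo c (lookup (tabulate unit)) ≡⟨ sym (lincomb≡combo c (tabulate unit)) ⟩
  lincomb c (tabulate unit)        ≡⟨ q ⟩
  0V                               ∎

-- Dividing out a vector w with wₚ = 1: adding uₚ·w clears coordinate p of u,
-- which is then deleted.  The resulting linear map has kernel {0, w}.
module Eliminate {m : ℕ} (w : V (suc m)) (p : Fin (suc m)) (wₚ : lookup w p ≡ true) where

  cleared : V (suc m) → V (suc m)
  cleared u = u ⊕ scale (lookup u p) w

  eliminate : V (suc m) → V m
  eliminate u = removeAt (cleared u) p

  lookup-cleared : ∀ u → lookup (cleared u) p ≡ false
  lookup-cleared u = begin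
    lookup (cleared u) p                        ≡⟨ lookup-⊕ u _ p ⟩
    lookup u p xor lookup (scale (lookup u p) w) p ≡⟨ cong (lookup u p xor_) (lookup-scale _ w p) ⟩
    lookup u p xor (lookup u p ∧ lookup w p)    ≡⟨ cong (λ b → lookup u p xor (lookup u p ∧ b)) wₚ ⟩
    lookup u p xor (lookup u p ∧ true)          ≡⟨ cong (lookup u p xor_) (∧-identityʳ _) ⟩
    lookup u p xor lookup u p                   ≡⟨ xor-same (lookup u p) ⟩
    false                                       ∎

  eliminate-linear : IsLinear eliminate
  eliminate-linear u v = begin
    removeAt ((u ⊕ v) ⊕ scale (lookup (u ⊕ v) p) w) p
      ≡⟨ cong (λ t → removeAt ((u ⊕ v) ⊕ t) p) (trans (cong (λ b → scale b w) (lookup-⊕ u v p)) (scale-xor (lookup u p) (lookup v p) w)) ⟩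
    removeAt ((u ⊕ v) ⊕ (scale (lookup u p) w ⊕ scale (lookup v p) w)) p
      ≡⟨ cong (λ t → removeAt t p) (⊕-interchange u v _ _) ⟩
    removeAt (cleared u ⊕ cleared v) p
      ≡⟨ removeAt-⊕ (cleared u) (cleared v) p ⟩
    eliminate u ⊕ eliminate v ∎

  eliminate-kernel : ∀ u → eliminate u ≡ 0V → u ≡ scale (lookup u p) w
  eliminate-kernel u e≡0 = ⊕≡0⇒≡ (removeAt≡0⇒0V (cleared u) p (lookup-cleared u) e≡0)

image-nonzero : ∀ {n k m} (h : V n) (gs : Vec (V n) k) → Independent (h ∷ gs) →
  (φ : V n → V m) → KernelInSpan φ gs → Σ (Fin m) λ p → lookup (φ h) p ≡ true
image-nonzero h gs ind φ ker with any? (λ p → lookup (φ h) p ≟B true)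
... | yes hit = hit
... | no none with ker h (allFalse⇒0V (φ h) (λ p → ¬-not (λ q → none (p , q))))
...   | c , c-spans-h with cong head (ind (true ∷ c) (trans (cong (h ⊕_) c-spans-h) (⊕-self h)))
...     | ()

extend-parityCheck : ∀ {n k m} (h : V n) (gs : Vec (V n) k) → m + k ≡ n →
  (φ : V n → V m) → IsLinear φ → KernelInSpan φ gs → (p : Fin m) → lookup (φ h) p ≡ true →
  Σ ℕ λ m' → (m' + suc k ≡ n) × Σ (V n → V m') λ φ' → IsLinear φ' × KernelInSpan φ' (h ∷ gs)
extend-parityCheck {m = zero} h gs _ φ lin ker () _
extend-parityCheck {k = k} {m = suc m} h gs m+k≡n φ lin ker p φhₚ =
  m , trans (+-suc m k) m+k≡n , eliminate ∘ φ , ∘-linear eliminate-linear lin ,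
  λ x z → fromImage x (lookup (φ x) p) (eliminate-kernel (φ x) z)
  where
  open Eliminate (φ h) p φhₚ
  fromImage : ∀ x b → φ x ≡ scale b (φ h) → InSpan (h ∷ gs) x
  fromImage x false φx≡0 with ker x φx≡0
  ... | c , c-spans-x = (false ∷ c) , trans (⊕-identityˡ _) c-spans-x
  fromImage x true φx≡φh with ker (x ⊕ h) (trans (lin x h) (≡⇒⊕≡0 φx≡φh))
  ... | c , c-spans = (true ∷ c) , (begin
    h ⊕ lincomb c gs ≡⟨ cong (h ⊕_) c-spans ⟩
    h ⊕ (x ⊕ h)      ≡⟨ cong (h ⊕_) (⊕-comm x h) ⟩
    h ⊕ (h ⊕ x)      ≡⟨ ⊕-absorbˡ h x ⟩
    x                ∎)

parityCheck : ∀ {n k} (g : Vec (V n) k) → Independent g →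
  Σ ℕ λ m → (m + k ≡ n) × Σ (V n → V m) λ φ → IsLinear φ × KernelInSpan φ g
parityCheck {n} [] _ = n , +-identityʳ n , (λ x → x) , (λ x y → refl) , λ x x≡0 → [] , sym x≡0
parityCheck (h ∷ gs) ind with parityCheck gs (independent-tail ind)
... | m , m+k≡n , φ , lin , ker with image-nonzero h gs ind φ ker
...   | p , φhₚ = extend-parityCheck h gs m+k≡n φ lin ker p φhₚ

head-combo : ∀ {s d} (x : V s) (vs : Fin s → V (suc d)) → (∀ i → lookup (vs i) zero ≡ false) →
  lookup (combo x vs) zero ≡ false
head-combo [] vs _ = refl
head-combo (b ∷ x) vs heads = begin
  lookup (scale b (vs zero) ⊕ combo x (vs ∘ suc)) zero            ≡⟨ lookup-⊕ (scale b (vs zero)) _ zero ⟩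
  lookup (scale b (vs zero)) zero xor lookup (combo x (vs ∘ suc)) zero
    ≡⟨ cong₂ _xor_ (trans (lookup-scale b (vs zero) zero) (trans (cong (b ∧_) (heads zero)) (∧-zeroʳ b)))
                   (head-combo x (vs ∘ suc) (heads ∘ suc)) ⟩
  false                                                           ∎

unit-hitting-head : ∀ {n d} (φ : V n → V (suc d)) → IsLinear φ → IsSurjective φ →
  Σ (Fin n) λ p → lookup (φ (unit p)) zero ≡ true
unit-hitting-head φ lin onto with any? (λ p → lookup (φ (unit p)) zero ≟B true)
... | yes hit = hit
... | no none with onto (true ∷ 0V)
...   | x , φx≡e₀ with trans (sym (cong (λ t → lookup t zero) φx≡e₀)) (begin
          lookup (φ x) zero                  ≡⟨ cong (λ t → lookup (φ t) zero) (sym (combo-units x)) ⟩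
          lookup (φ (combo x unit)) zero     ≡⟨ cong (λ t → lookup t zero) (linear-combo φ lin x unit) ⟩
          lookup (combo x (φ ∘ unit)) zero   ≡⟨ head-combo x (φ ∘ unit) (λ i → ¬-not (λ q → none (i , q))) ⟩
          false                              ∎)
...     | ()

-- Given surjective linear φ : F₂ⁿ⁺¹ → F₂ᵈ⁺¹ and p with (φ eₚ)₀ = 1, the map
-- lift y = ins y + β(y)·eₚ, where ins y inserts 0 at p and β(y) = (φ (ins y))₀,
-- is a linear section of deleting p on which φ has first coordinate 0; the other
-- coordinates give a surjective linear ψ : F₂ⁿ → F₂ᵈ, and independent vectors in
-- ker ψ lift to independent vectors in ker φ.
module Lift {d n : ℕ} (φ : V (suc n) → V (suc d)) (lin : IsLinear φ) (onto : IsSurjective φ)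
  (p : Fin (suc n)) (φeₚ : lookup (φ (unit p)) zero ≡ true) where

  ins : V n → V (suc n)
  ins y = insertAt y p false

  correction : V n → Bool
  correction y = lookup (φ (ins y)) zero

  lift : V n → V (suc n)
  lift y = ins y ⊕ scale (correction y) (unit p)

  ψ : V n → V d
  ψ y = tail (φ (lift y))

  head-φ-ins⊕ : ∀ y b → lookup (φ (ins y ⊕ scale b (unit p))) zero ≡ correction y xor b
  head-φ-ins⊕ y b = begin
    lookup (φ (ins y ⊕ scale b (unit p))) zero
      ≡⟨ cong (λ t → lookup t zero) (trans (lin _ _) (cong (φ (ins y) ⊕_) (linear-scale φ lin b (unit p)))) ⟩
    lookup (φ (ins y) ⊕ scale b (φ (unit p))) zero ≡⟨ lookup-⊕ (φ (ins y)) _ zero ⟩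
    correction y xor lookup (scale b (φ (unit p))) zero ≡⟨ cong (correction y xor_) (lookup-scale b _ zero) ⟩
    correction y xor (b ∧ lookup (φ (unit p)) zero) ≡⟨ cong (λ t → correction y xor (b ∧ t)) φeₚ ⟩
    correction y xor (b ∧ true)                 ≡⟨ cong (correction y xor_) (∧-identityʳ b) ⟩
    correction y xor b                          ∎

  φ-lift : ∀ y → φ (lift y) ≡ false ∷ ψ y
  φ-lift y with φ (lift y) | trans (head-φ-ins⊕ y (correction y)) (xor-same (correction y))
  ... | false ∷ rest | _ = refl

  ins-linear : IsLinear ins
  ins-linear y z = insertAt-⊕ y z p false false

  lift-linear : IsLinear lift
  lift-linear y z = begin
    ins (y ⊕ z) ⊕ scale (correction (y ⊕ z)) (unit p)
      ≡⟨ cong₂ _⊕_ (ins-linear y z) (trans (cong (λ b → scale b (unit p)) correction-linear) (scale-xor (correction y) (correction z) (unit p))) ⟩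
    (ins y ⊕ ins z) ⊕ (scale (correction y) (unit p) ⊕ scale (correction z) (unit p))
      ≡⟨ ⊕-interchange (ins y) (ins z) _ _ ⟩
    lift y ⊕ lift z ∎
    where
    correction-linear : correction (y ⊕ z) ≡ correction y xor correction z
    correction-linear =
      trans (cong (λ t → lookup t zero) (trans (cong φ (ins-linear y z)) (lin (ins y) (ins z))))
            (lookup-⊕ (φ (ins y)) (φ (ins z)) zero)

  removeAt-lift : ∀ y → removeAt (lift y) p ≡ y
  removeAt-lift y = begin
    removeAt (lift y) p ≡⟨ removeAt-⊕ (ins y) _ p ⟩
    removeAt (ins y) p ⊕ removeAt (scale (correction y) (unit p)) p
      ≡⟨ cong₂ _⊕_ (removeAt-insertAt y p false) (removeAt-scale-unit (correction y) p) ⟩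
    y ⊕ 0V              ≡⟨ ⊕-identityʳ y ⟩
    y                   ∎

  ψ-linear : IsLinear ψ
  ψ-linear y z = trans (cong tail (trans (cong φ (lift-linear y z)) (lin _ _))) (tail-⊕ (φ (lift y)) (φ (lift z)))
    where
    tail-⊕ : ∀ {k} (u v : V (suc k)) → tail (u ⊕ v) ≡ tail u ⊕ tail v
    tail-⊕ (a ∷ u) (b ∷ v) = refl

  lift-removeAt : ∀ x → lookup (φ x) zero ≡ false → lift (removeAt x p) ≡ x
  lift-removeAt x φx₀ = begin
    ins y ⊕ scale (correction y) (unit p)   ≡⟨ cong (λ b → ins y ⊕ scale b (unit p)) correction≡xₚ ⟩
    ins y ⊕ scale (lookup x p) (unit p)     ≡⟨ sym (decompose x p) ⟩
    x                                       ∎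
    where
    y = removeAt x p
    correction≡xₚ : correction y ≡ lookup x p
    correction≡xₚ = xor≡false⇒≡ (begin
      correction y xor lookup x p              ≡⟨ sym (head-φ-ins⊕ y (lookup x p)) ⟩
      lookup (φ (ins y ⊕ scale (lookup x p) (unit p))) zero ≡⟨ cong (λ t → lookup (φ t) zero) (sym (decompose x p)) ⟩
      lookup (φ x) zero                        ≡⟨ φx₀ ⟩
      false                                    ∎)

  ψ-surjective : IsSurjective ψ
  ψ-surjective z with onto (false ∷ z)
  ... | x , φx≡0z = removeAt x p , (begin
    tail (φ (lift (removeAt x p))) ≡⟨ cong (tail ∘ φ) (lift-removeAt x (cong (λ t → lookup t zero) φx≡0z)) ⟩
    tail (φ x)                     ≡⟨ cong tail φx≡0z ⟩
    z                              ∎)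

  lift-basis : ∀ {k} (g : Vec (V n) k) → Independent g → SpanInKernel ψ g →
    Independent (map lift g) × SpanInKernel φ (map lift g)
  lift-basis g ind ker = independent , inKernel
    where
    independent : Independent (map lift g)
    independent c q = ind c (begin
      lincomb c g                         ≡⟨ sym (removeAt-lift _) ⟩
      removeAt (lift (lincomb c g)) p     ≡⟨ cong (λ t → removeAt t p) (sym (lincomb-map lift lift-linear c g)) ⟩
      removeAt (lincomb c (map lift g)) p ≡⟨ cong (λ t → removeAt t p) q ⟩
      removeAt 0V p                       ≡⟨ removeAt-0V p ⟩
      0V                                  ∎)
    inKernel : SpanInKernel φ (map lift g)
    inKernel c = begin
      φ (lincomb c (map lift g)) ≡⟨ cong φ (lincomb-map lift lift-linear c g) ⟩
      φ (lift (lincomb c g))     ≡⟨ φ-lift _ ⟩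
      false ∷ ψ (lincomb c g)    ≡⟨ cong (false ∷_) (ker c) ⟩
      0V                         ∎

kernelBasis : ∀ d {n} (φ : V n → V d) → IsLinear φ → IsSurjective φ →
  Σ ℕ λ k → (k + d ≡ n) × Σ (Vec (V n) k) λ g → Independent g × SpanInKernel φ g
kernelBasis zero {n} φ lin onto = n , +-identityʳ n , tabulate unit , units-independent , λ c → V0-trivial _
kernelBasis (suc d) {n} φ lin onto with unit-hitting-head φ lin onto
kernelBasis (suc d) {zero} φ lin onto | () , _
kernelBasis (suc d) {suc n} φ lin onto | p , φeₚ with kernelBasis d ψ ψ-linear ψ-surjective
  where open Lift φ lin onto p φeₚ
... | k , k+d≡n , g , ind , ker = k , trans (+-suc k d) (cong suc k+d≡n) , map lift g , lift-basis g ind ker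
  where open Lift φ lin onto p φeₚ

Searchable : Set → Set₁
Searchable A = ∀ {Q : A → Set} → (∀ a → Dec (Q a)) → Dec (Σ A Q)

searchBool : Searchable Bool
searchBool Q? with Q? true | Q? false
... | yes q | _ = yes (true , q)
... | no _ | yes q = yes (false , q)
... | no ¬qt | no ¬qf = no λ { (true , q) → ¬qt q ; (false , q) → ¬qf q }

searchVec : ∀ {A} → Searchable A → ∀ m → Searchable (Vec A m)
searchVec search zero Q? with Q? []
... | yes q = yes ([] , q)
... | no ¬q = no λ { ([] , q) → ¬q q }
searchVec search (suc m) {Q} Q? with search (λ a → searchVec search m (λ v → Q? (a ∷ v)))
... | yes (a , v , q) = yes (a ∷ v , q)
... | no ¬q = no λ { (a ∷ v , q) → ¬q (a , v , q) }

searchV : ∀ n → Searchable (V n)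
searchV n = searchVec searchBool n

_≟V_ : ∀ {n} (x y : V n) → Dec (x ≡ y)
_≟V_ = ≡-dec _≟B_

zeroSum4? : ∀ {s d} (f : Fin s → V d) → Dec (HasZeroSum4 f)
zeroSum4? f = any? λ i → any? λ j → any? λ k → any? λ l →
  ((i FP.<? j) ×-dec (j FP.<? k) ×-dec (k FP.<? l)) ×-dec (((f i ⊕ f j) ⊕ (f k ⊕ f l)) ≟V 0V)

injective? : ∀ {s d} (f : Fin s → V d) → Dec (Injective _≡_ _≡_ f)
injective? f with all? (λ x → all? (λ y → (f x ≟V f y) →-dec (x FP.≟ y)))
... | yes inj = yes (λ {x} {y} → inj x y)
... | no ¬inj = no (λ inj → ¬inj (λ x y → inj))

beta4Set? : ∀ d m → Dec (Beta4Set d m)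
beta4Set? d m with searchVec (searchV d) m (λ v → injective? (lookup v) ×-dec ¬? (zeroSum4? (lookup v)))
... | yes (v , ok) = yes (lookup v , ok)
... | no none = no λ { (f , inj , free) → none (tabulate f ,
      (λ {x} {y} q → inj (trans (sym (lookup∘tabulate f x)) (trans q (lookup∘tabulate f y)))) ,
      (λ z → free (zeroSum4-cong (lookup∘tabulate f) z))) }

bit : Bool → Fin 2
bit true = zero
bit false = suc zero

encode : ∀ {d} → V d → Fin (2 ^ d)
encode {zero} [] = zero
encode {suc d} (b ∷ x) = F.combine (bit b) (encode x)

bit-injective : ∀ a b → bit a ≡ bit b → a ≡ b
bit-injective true true _ = refl
bit-injective false false _ = refl

encode-injective : ∀ {d} (x y : V d) → encode x ≡ encode y → x ≡ y
encode-injective [] [] _ = refl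
encode-injective (a ∷ x) (b ∷ y) q with FP.combine-injective (bit a) (encode x) (bit b) (encode y) q
... | bits≡ , rest≡ = cong₂ _∷_ (bit-injective a b bits≡) (encode-injective x y rest≡)

beta4Set-bound : ∀ {d m} → Beta4Set d m → m ≤ 2 ^ d
beta4Set-bound (f , inj , _) = FP.injective⇒≤ {f = encode ∘ f} (inj ∘ encode-injective _ _)

largestUpTo : (P : ℕ → Set) → (∀ m → Dec (P m)) → P 0 → ∀ k →
  Σ ℕ λ b → P b × (∀ m → m ≤ k → P m → m ≤ b)
largestUpTo P P? p0 zero = 0 , p0 , λ { m z≤n _ → z≤n }
largestUpTo P P? p0 (suc k) with P? (suc k)
... | yes p = suc k , p , λ m m≤ _ → m≤
... | no ¬p with largestUpTo P P? p0 k
...   | b , pb , largest = b , pb , λ m m≤ pm → below m pm (ℕP.m≤n⇒m<n∨m≡n m≤)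
  where
  below : ∀ m → P m → (m < suc k) ⊎ (m ≡ suc k) → m ≤ b
  below m pm (inj₁ (s≤s m≤k)) = largest m m≤k pm
  below m pm (inj₂ refl) = ⊥-elim (¬p pm)

beta4Set-empty : ∀ d → Beta4Set d 0
beta4Set-empty d = (λ ()) , (λ { {()} }) , λ { (() , _) }

beta4Set-singleton : ∀ d → Beta4Set d 1
beta4Set-singleton d = (λ _ → 0V) , (λ { {zero} {zero} _ → refl }) , λ { (zero , zero , _ , _ , (() , _) , _) }

beta4-exists : ∀ d → Σ ℕ λ b → IsBeta4 d b
beta4-exists d with largestUpTo (Beta4Set d) (beta4Set? d) (beta4Set-empty d) (2 ^ d)
... | b , set , largest = b , set , λ m set' → largest m (beta4Set-bound set') set'

s4Property-mono : ∀ {d t u} → t ≤ u → S4Property d t → S4Property d u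
s4Property-mono t≤u s4 g =
  zeroSum4-reindex g (λ i → F.inject≤ i t≤u) (λ {i} {j} → FP.inject≤-injective t≤u t≤u i j) (s4 (λ i → g (F.inject≤ i t≤u)))

Repetition : ∀ {s d} → (Fin s → V d) → Set
Repetition {s} g = Σ (Fin s) λ i → Σ (Fin s) λ j → i ≢ j × g i ≡ g j

repetition : ∀ {s d b} → (∀ m → Beta4Set d m → m ≤ b) → b < s →
  (g : Fin s → V d) → ¬ HasZeroSum4 g → Repetition g
repetition {b = b} maximal b<s g free with any? (λ i → any? λ j → ¬? (i FP.≟ j) ×-dec (g i ≟V g j))
... | yes rep = rep
... | no ¬rep = ⊥-elim (n≮n b (ℕP.<-≤-trans b<s (maximal _ (g , injective , free))))
  where
  injective : Injective _≡_ _≡_ g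
  injective {i} {j} gi≡gj with i FP.≟ j
  ... | yes i≡j = i≡j
  ... | no i≢j = ⊥-elim (¬rep (i , j , i≢j , gi≡gj))

zeroSumFree-delete : ∀ {s d} (g : Fin (suc s) → V d) j → ¬ HasZeroSum4 g → ¬ HasZeroSum4 (g ∘ punchIn j)
zeroSumFree-delete g j free = free ∘ zeroSum4-reindex g (punchIn j) (punchIn-injective j _ _)

-- Three successive repetitions — (i, j) in g, (i₁, j₁) after deleting j, and
-- (i₂, j₂) after also deleting j₁ — yield two repeated pairs at four distinct
-- positions: either (i, j), (i₁, j₁), or (j, j₁) and (i₂, j₂) when gᵢ = g_{i₁}.
threeRepetitions : ∀ {s d} (g : Fin (suc (suc s)) → V d) → (r : Repetition g) →
  (r₁ : Repetition (g ∘ punchIn (proj₁ (proj₂ r)))) →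
  Repetition (g ∘ punchIn (proj₁ (proj₂ r)) ∘ punchIn (proj₁ (proj₂ r₁))) → HasZeroSum4 g
threeRepetitions {s} g (i , j , i≢j , gi≡gj) (i₁ , j₁ , i₁≢j₁ , gI₁≡gJ₁) (i₂ , j₂ , i₂≢j₂ , gI₂≡gJ₂)
  with g i ≟V g (punchIn j i₁)
... | no gi≢gI₁ = zeroSum4-twoPairs g i j I₁ J₁ i≢j (gi≢gI₁ ∘ cong g) (gi≢gI₁ ∘ λ q → trans (cong g q) (sym gI₁≡gJ₁))
      (j≢ i₁) (j≢ j₁) (i₁≢j₁ ∘ punchIn-injective j i₁ j₁) gi≡gj gI₁≡gJ₁
  where
  I₁ J₁ : Fin (suc (suc s))
  I₁ = punchIn j i₁
  J₁ = punchIn j j₁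
  j≢ : ∀ x → j ≢ punchIn j x
  j≢ x = punchInᵢ≢i j x ∘ sym
... | yes gi≡gI₁ = zeroSum4-twoPairs g j J₁ I₂ J₂ (j≢ j₁) (j≢ _) (j≢ _)
      (j₁≢ i₂ ∘ punchIn-injective j j₁ _) (j₁≢ j₂ ∘ punchIn-injective j j₁ _)
      (i₂≢j₂ ∘ punchIn-injective j₁ i₂ j₂ ∘ punchIn-injective j _ _)
      (trans (sym gi≡gj) (trans gi≡gI₁ gI₁≡gJ₁)) gI₂≡gJ₂
  where
  J₁ I₂ J₂ : Fin (suc (suc s))
  J₁ = punchIn j j₁
  I₂ = punchIn j (punchIn j₁ i₂)
  J₂ = punchIn j (punchIn j₁ j₂)
  j≢ : ∀ x → j ≢ punchIn j x
  j≢ x = punchInᵢ≢i j x ∘ sym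
  j₁≢ : ∀ x → j₁ ≢ punchIn j₁ x
  j₁≢ x = punchInᵢ≢i j₁ x ∘ sym

s4-upper : ∀ {d b} → (∀ m → Beta4Set d m → m ≤ b) → S4Property d (3 + b)
s4-upper {d} {b} maximal g with zeroSum4? g
... | yes z = z
... | no free = threeRepetitions g r r₁ r₂
  where
  r : Repetition g
  r = repetition maximal (ℕP.≤-trans (ℕP.n≤1+n _) (ℕP.n≤1+n _)) g free
  g₁ : Fin (2 + b) → V d
  g₁ = g ∘ punchIn (proj₁ (proj₂ r))
  free₁ : ¬ HasZeroSum4 g₁
  free₁ = zeroSumFree-delete g _ free
  r₁ : Repetition g₁
  r₁ = repetition maximal (ℕP.n≤1+n _) g₁ free₁
  r₂ : Repetition (g₁ ∘ punchIn (proj₁ (proj₂ r₁)))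
  r₂ = repetition maximal ℕP.≤-refl (g₁ ∘ punchIn (proj₁ (proj₂ r₁))) (zeroSumFree-delete g₁ _ free₁)

module LowerBound {d n : ℕ} (f : Fin (suc n) → V d) (inj : Injective _≡_ _≡_ f) (free : ¬ HasZeroSum4 f) where

  x : V d
  x = f zero

  -- x + x + f k + f l = 0 would force f k = f l.
  noPair : ∀ {k l} → k F.< l → (x ⊕ x) ⊕ (f k ⊕ f l) ≢ 0V
  noPair {k} {l} k<l sum≡0 = <⇒≢ k<l (inj (⊕≡0⇒≡ (begin
    f k ⊕ f l             ≡⟨ sym (⊕-identityˡ _) ⟩
    0V ⊕ (f k ⊕ f l)      ≡⟨ cong (_⊕ (f k ⊕ f l)) (sym (⊕-self x)) ⟩
    (x ⊕ x) ⊕ (f k ⊕ f l) ≡⟨ sum≡0 ⟩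
    0V                    ∎)))

  -- x together with three entries of f: either one of them is x itself, or
  -- the four are distinct elements of the set.
  noZeroSumWith-f : ¬ ZeroSumWith f x
  noZeroSumWith-f (zero , k , l , (_ , k<l) , sum≡0) = noPair k<l sum≡0
  noZeroSumWith-f (suc j , k , l , (j<k , k<l) , sum≡0) = free (zero , suc j , k , l , (s≤s z≤n , j<k , k<l) , sum≡0)

  -- Hence x ◂ f is zero-sum-free, and so is x ◂ (x ◂ f), whose zero sums
  -- through the new x would again pair x with itself or with three entries of f.
  free₁ : ¬ HasZeroSum4 (x ◂ f)
  free₁ z with zeroSum4-prepend x f z
  ... | inj₁ z' = free z'
  ... | inj₂ z' = noZeroSumWith-f z'

  noZeroSumWith-xf : ¬ ZeroSumWith (x ◂ f) x
  noZeroSumWith-xf (zero , suc k , suc l , (_ , s≤s k<l) , sum≡0) = noPair k<l sum≡0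
  noZeroSumWith-xf (suc j , suc k , suc l , (s≤s j<k , s≤s k<l) , sum≡0) = noZeroSumWith-f (j , k , l , (j<k , k<l) , sum≡0)
  noZeroSumWith-xf (zero , zero , _ , (() , _) , _)
  noZeroSumWith-xf (_ , suc k , zero , (_ , ()) , _)
  noZeroSumWith-xf (suc j , zero , _ , (() , _) , _)

  s4-lower : ¬ S4Property d (3 + n)
  s4-lower s4 with zeroSum4-prepend x (x ◂ f) (s4 (x ◂ (x ◂ f)))
  ... | inj₁ z = free₁ z
  ... | inj₂ z = noZeroSumWith-xf z

-- s₄(ℤ₂ᵈ) = β + 3, minimality coming from the lower bound and monotonicity.
s4≡β+3 : ∀ {d n} → IsBeta4 d (suc n) → IsS4 d (suc n + 3)
s4≡β+3 {d} {n} ((f , inj , free) , maximal) = subst (IsS4 d) (+-comm 3 (suc n)) (s4-upper maximal , minimal)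
  where
  minimal : ∀ t → S4Property d t → 3 + suc n ≤ t
  minimal t s4 with (3 + suc n) ℕP.≤? t
  ... | yes ok = ok
  ... | no too-small = ⊥-elim (LowerBound.s4-lower f inj free (s4Property-mono (s≤s⁻¹ (ℕP.≰⇒> too-small)) s4))

codeOfBasis : ∀ {n r k δ} → k + r ≡ n → (g : Vec (V n) k) → Independent g →
  (∀ c → c ≢ 0V → δ ≤ weight (lincomb c g)) → CodeExists n r δ
codeOfBasis {r = r} {k} refl g ind dist rewrite ℕP.m+n∸n≡m k r = ℕP.m≤n+m r k , g , ind , dist

module SetToCode {d n : ℕ} (f : Fin (suc n) → V d) (inj : Injective _≡_ _≡_ f) (free : ¬ HasZeroSum4 f)
  (maximal : ∀ m → Beta4Set d m → m ≤ suc n) where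

  -- Translating by f zero makes the first element 0 and preserves sums of
  -- four elements.
  f' : Fin (suc n) → V d
  f' i = f i ⊕ f zero

  f'-injective : Injective _≡_ _≡_ f'
  f'-injective q = inj (⊕-injectiveʳ q)

  f'-free : ¬ HasZeroSum4 f'
  f'-free (i , j , k , l , ordered , sum≡0) = free (i , j , k , l , ordered ,
    trans (sym (cong₂ _⊕_ (⊕-translate (f i) (f j) (f zero)) (⊕-translate (f k) (f l) (f zero)))) sum≡0)

  -- The nonzero elements are the columns of a parity-check matrix.
  h : Fin n → V d
  h j = f' (suc j)

  syndrome : V n → V d
  syndrome x = combo x h

  syndrome-linear : IsLinear syndrome
  syndrome-linear x y = combo-⊕ x y h

  f'-syndrome : ∀ i → Σ (V n) λ c → syndrome c ≡ f' i
  f'-syndrome zero = 0V , trans (combo-0V h) (sym (⊕-self (f zero)))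
  f'-syndrome (suc j) = unit j , combo-unit j h

  -- By maximality every y is a syndrome: otherwise y could be added to f'.
  syndrome-surjective : IsSurjective syndrome
  syndrome-surjective y with searchV n (λ c → syndrome c ≟V y)
  ... | yes found = found
  ... | no none = ⊥-elim (n≮n (suc n) (maximal (suc (suc n)) (y ◂ f' , injective , free')))
    where
    injective : Injective _≡_ _≡_ (y ◂ f')
    injective {zero} {zero} _ = refl
    injective {zero} {suc b} q = ⊥-elim (none (proj₁ (f'-syndrome b) , trans (proj₂ (f'-syndrome b)) (sym q)))
    injective {suc a} {zero} q = ⊥-elim (none (proj₁ (f'-syndrome a) , trans (proj₂ (f'-syndrome a)) q))
    injective {suc a} {suc b} q = cong suc (f'-injective q)
    free' : ¬ HasZeroSum4 (y ◂ f')
    free' z with zeroSum4-prepend y f' z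
    ... | inj₁ z' = f'-free z'
    ... | inj₂ (j , k , l , _ , sum≡0) with f'-syndrome j | f'-syndrome k | f'-syndrome l
    ...   | cj , sj | ck , sk | cl , sl = none (cj ⊕ (ck ⊕ cl) , (begin
      syndrome (cj ⊕ (ck ⊕ cl))                    ≡⟨ syndrome-linear cj _ ⟩
      syndrome cj ⊕ syndrome (ck ⊕ cl)             ≡⟨ cong (syndrome cj ⊕_) (syndrome-linear ck cl) ⟩
      syndrome cj ⊕ (syndrome ck ⊕ syndrome cl)    ≡⟨ cong₂ _⊕_ sj (cong₂ _⊕_ sk sl) ⟩
      f' j ⊕ (f' k ⊕ f' l)                         ≡⟨ sym (⊕≡0⇒≡ (trans (sym (⊕-assoc y (f' j) _)) sum≡0)) ⟩
      y                                            ∎))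

  -- One to four distinct columns never sum to zero: together with f' zero = 0
  -- they would give two equal elements or four elements of f' summing to zero.
  noShortZeroSum : (l : List (Fin n)) → Sorted l → 1 ≤ length l → length l ≤ 4 → sumOver h l ≢ 0V
  noShortZeroSum (a ∷ []) _ _ _ sum≡0 with f'-injective {suc a} {zero} (begin
    h a       ≡⟨ sym (⊕-identityʳ (h a)) ⟩
    h a ⊕ 0V  ≡⟨ sum≡0 ⟩
    0V        ≡⟨ sym (⊕-self (f zero)) ⟩
    f' zero   ∎)
  ... | ()
  noShortZeroSum (a ∷ b ∷ []) (a<b , _) _ _ sum≡0 =
    <⇒≢ a<b (FP.suc-injective (f'-injective (⊕≡0⇒≡ (trans (cong (h a ⊕_) (sym (⊕-identityʳ (h b)))) sum≡0))))
  noShortZeroSum (a ∷ b ∷ c ∷ []) (a<b , b<c , _) _ _ sum≡0 = f'-free (zero , suc a , suc b , suc c ,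
    (s≤s z≤n , s≤s a<b , s≤s b<c) , (begin
      (f' zero ⊕ h a) ⊕ (h b ⊕ h c) ≡⟨ cong (λ t → (t ⊕ h a) ⊕ (h b ⊕ h c)) (⊕-self (f zero)) ⟩
      (0V ⊕ h a) ⊕ (h b ⊕ h c)      ≡⟨ cong (_⊕ (h b ⊕ h c)) (⊕-identityˡ (h a)) ⟩
      h a ⊕ (h b ⊕ h c)             ≡⟨ cong (λ t → h a ⊕ (h b ⊕ t)) (sym (⊕-identityʳ (h c))) ⟩
      sumOver h (a ∷ b ∷ c ∷ [])    ≡⟨ sum≡0 ⟩
      0V                            ∎))
  noShortZeroSum (a ∷ b ∷ c ∷ k ∷ []) (a<b , b<c , c<k , _) _ _ sum≡0 = f'-free (suc a , suc b , suc c , suc k ,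
    (s≤s a<b , s≤s b<c , s≤s c<k) , (begin
      (h a ⊕ h b) ⊕ (h c ⊕ h k)         ≡⟨ ⊕-assoc (h a) (h b) _ ⟩
      h a ⊕ (h b ⊕ (h c ⊕ h k))         ≡⟨ cong (λ t → h a ⊕ (h b ⊕ (h c ⊕ t))) (sym (⊕-identityʳ (h k))) ⟩
      sumOver h (a ∷ b ∷ c ∷ k ∷ [])    ≡⟨ sum≡0 ⟩
      0V                                ∎))
  noShortZeroSum (_ ∷ _ ∷ _ ∷ _ ∷ _ ∷ _) _ _ (s≤s (s≤s (s≤s (s≤s ())))) _

  distance : ∀ {k} (g : Vec (V n) k) → Independent g → SpanInKernel syndrome g →
    ∀ c → c ≢ 0V → 5 ≤ weight (lincomb c g)
  distance g ind ker c c≢0 with 5 ℕP.≤? weight (lincomb c g)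
  ... | yes heavy = heavy
  ... | no light = ⊥-elim (noShortZeroSum (support x) (sorted-support x)
      (subst (1 ≤_) (sym (length-support x)) (weight-positive x (c≢0 ∘ ind c)))
      (subst (_≤ 4) (sym (length-support x)) (s≤s⁻¹ (ℕP.≰⇒> light)))
      (trans (sym (combo≡sumOver-support x h)) (ker c)))
    where
    x : V n
    x = lincomb c g

  code : CodeExists n d 5
  code with kernelBasis d syndrome syndrome-linear syndrome-surjective
  ... | k , k+d≡n , g , ind , ker = codeOfBasis k+d≡n g ind (distance g ind ker)

module CodeToSet {d n : ℕ} (g : Vec (V n) (n ∸ d)) (dist : ∀ c → c ≢ 0V → 5 ≤ weight (lincomb c g))
  (φ : V n → V d) (lin : IsLinear φ) (ker : KernelInSpan φ g) where

  light-not-in-kernel : ∀ x {w} → weight x ≡ suc w → suc w ≤ 4 → φ x ≢ 0V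
  light-not-in-kernel x {w} wx light φx≡0 with ker x φx≡0
  ... | c , c-spans-x with c ≟V 0V
  ...   | yes c≡0 = weight≡suc⇒≢0V x wx (begin
    x                  ≡⟨ sym c-spans-x ⟩
    lincomb c g        ≡⟨ cong (λ t → lincomb t g) c≡0 ⟩
    lincomb 0V g       ≡⟨ lincomb≡combo 0V g ⟩
    combo 0V (lookup g) ≡⟨ combo-0V {n ∸ d} (lookup g) ⟩
    0V                 ∎)
  ...   | no c≢0 = n≮n 4 (ℕP.≤-trans (subst (5 ≤_) (trans (cong weight c-spans-x) wx) (dist c c≢0)) light)

  f : Fin (suc n) → V d
  f = 0V ◂ (φ ∘ unit)

  φ-units₃ : ∀ j k l → φ (unit j ⊕ (unit k ⊕ unit l)) ≡ φ (unit j) ⊕ (φ (unit k) ⊕ φ (unit l))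
  φ-units₃ j k l = trans (lin _ _) (cong (φ (unit j) ⊕_) (lin _ _))

  injective : Injective _≡_ _≡_ f
  injective {zero} {zero} _ = refl
  injective {zero} {suc b} q = ⊥-elim (light-not-in-kernel (unit b) (weight-unit b) (s≤s z≤n) (sym q))
  injective {suc a} {zero} q = ⊥-elim (light-not-in-kernel (unit a) (weight-unit a) (s≤s z≤n) q)
  injective {suc a} {suc b} q with a FP.≟ b
  ... | yes a≡b = cong suc a≡b
  ... | no a≢b = ⊥-elim (light-not-in-kernel (unit a ⊕ unit b) (weight-units₂ a≢b) (s≤s (s≤s z≤n))
      (trans (lin _ _) (≡⇒⊕≡0 q)))

  -- Three or four distinct columns summing to zero would be a light kernel vector.
  zeroSumFree : ¬ HasZeroSum4 f
  zeroSumFree z with zeroSum4-prepend 0V (φ ∘ unit) z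
  ... | inj₂ (j , k , l , (j<k , k<l) , sum≡0) =
    light-not-in-kernel (unit j ⊕ (unit k ⊕ unit l))
      (weight-units₃ (<⇒≢ j<k) (<⇒≢ (FP.<-trans j<k k<l)) (<⇒≢ k<l)) (s≤s (s≤s (s≤s z≤n)))
      (trans (φ-units₃ j k l) (trans (cong (_⊕ _) (sym (⊕-identityˡ (φ (unit j))))) sum≡0))
  ... | inj₁ (i , j , k , l , (i<j , j<k , k<l) , sum≡0) =
    light-not-in-kernel (unit i ⊕ (unit j ⊕ (unit k ⊕ unit l)))
      (weight-units₄ (<⇒≢ i<j) (<⇒≢ (FP.<-trans i<j j<k)) (<⇒≢ (FP.<-trans i<j (FP.<-trans j<k k<l)))
                     (<⇒≢ j<k) (<⇒≢ (FP.<-trans j<k k<l)) (<⇒≢ k<l)) ℕP.≤-refl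
      (trans (lin _ _) (trans (cong (φ (unit i) ⊕_) (φ-units₃ j k l)) (trans (sym (⊕-assoc (φ (unit i)) _ _)) sum≡0)))

  set : Beta4Set d (suc n)
  set = f , injective , zeroSumFree

-- Every code of length n, redundancy d and distance ≥ 5 yields a zero-sum-free
-- set of size n + 1; its parity-check map has exactly d coordinates.
codeToSet : ∀ {d n} → CodeExists n d 5 → Beta4Set d (suc n)
codeToSet {d} {n} (d≤n , g , ind , dist) with parityCheck g ind
... | m , m+k≡n , φ , lin , ker with ℕP.+-cancelʳ-≡ (n ∸ d) m d (trans m+k≡n (sym (ℕP.m+[n∸m]≡n d≤n)))
...   | refl = CodeToSet.set g dist φ lin ker

-- N(d,5) = β - 1: the maximal set gives a code of length β - 1, and any longer
-- code would give a zero-sum-free set larger than β.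
N≡β-1 : ∀ {d n} → IsBeta4 d (suc n) → IsN d 5 n
N≡β-1 ((f , inj , free) , maximal) =
  SetToCode.code f inj free maximal , λ m code → s≤s⁻¹ (maximal (suc m) (codeToSet code))

theorem7 : (d : ℕ) → 1 ≤ d →
    Σ ℕ λ s → Σ ℕ λ b → Σ ℕ λ n →
      IsS4 d s × IsBeta4 d b × IsN d 5 n ×
      s ≡ b + 3 × b + 3 ≡ n + 4
theorem7 d _ with beta4-exists d
... | zero , (_ , maximal) = ⊥-elim (n≮n 0 (maximal 1 (beta4Set-singleton d)))
... | suc n , isβ = suc n + 3 , suc n , n , s4≡β+3 isβ , isβ , N≡β-1 isβ , refl , sym (+-suc n 3)
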